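{- Let $\Delta\ge0$ be an integer. There exists a rooted edge-colored tree $T=T(\Delta)$ such that: (a) for every leaf $v$ of $T$ there is a color $c_v$ such that all leaves other than $v$ become disconnected from the root in $T-c_v$; (b) each color appears on at most $\Delta$ edges of $T$; (c) $T$ has $2^\Delta$ leaves; (d) $T$ has $\Delta 2^\Delta$ edges.
   Context: An edge-colored tree assigns each edge exactly one color, with no restrictions. $T-c$ denotes $T$ with all edges of color $c$ deleted. -}

module Defs where

open import Data.Nat using (ℕ; zero; suc; _+_)
open import Data.List using (List; []; _∷_)
open import Data.List.Membership.Propositional using (_∈_)
open import Data.List.Relation.Unary.Any using (here; there)
open import Data.Product using (_×_; _,_)
open import Relation.Binary.PropositionalEquality using (_≡_)
open import Relation.Nullary using (¬_)
open import Relation.Nullary.Decidable using (⌊_⌋)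
open import Data.Bool using (if_then_else_)
import Data.Nat as N

Color : Set
Color = ℕ

data Tree : Set where
  node : List (Color × Tree) → Tree

children : Tree → List (Color × Tree)
children (node cs) = cs

-- Vertices of a tree, as positions (paths from the root).
-- Distinct occurrences in the children list give distinct vertices.
data Pos : Tree → Set where
  root  : ∀ {t} → Pos t
  child : ∀ {cs c s} → (c , s) ∈ cs → Pos s → Pos (node cs)

subtree : ∀ {t} → Pos t → Tree
subtree {t} root = t
subtree (child _ p) = subtree p

IsLeaf : ∀ {t} → Pos t → Set
IsLeaf p = children (subtree p) ≡ []

pathColors : ∀ {t} → Pos t → List Color
pathColors root = []
pathColors (child {c = c} _ p) = c ∷ pathColors p

ConnectedToRoot : ∀ {t} → Color → Pos t → Set
ConnectedToRoot c p = ¬ (c ∈ pathColors p)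

mutual
  leafCount : Tree → ℕ
  leafCount (node []) = 1
  leafCount (node (e ∷ es)) = leafCountL (e ∷ es)

  leafCountL : List (Color × Tree) → ℕ
  leafCountL [] = 0
  leafCountL ((_ , s) ∷ es) = leafCount s + leafCountL es

mutual
  edgeCount : Tree → ℕ
  edgeCount (node cs) = edgeCountL cs

  edgeCountL : List (Color × Tree) → ℕ
  edgeCountL [] = 0
  edgeCountL ((_ , s) ∷ es) = suc (edgeCount s + edgeCountL es)

mutual
  colorCount : Color → Tree → ℕ
  colorCount c (node cs) = colorCountL c cs

  colorCountL : Color → List (Color × Tree) → ℕ
  colorCountL c [] = 0
  colorCountL c ((d , s) ∷ es) =
    (if ⌊ c N.≟ d ⌋ then 1 else 0) + colorCount c s + colorCountL c es

-- Build T(d) on the 2^d colours lo, …, lo + 2^d − 1 by recursion on d.  T(d+1) has two root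
-- edges; below the first hangs a path coloured by the upper half of the colours and then a copy
-- of T(d) on the lower half, below the second a path coloured by the lower half and then a copy
-- of T(d) on the upper half.  A leaf keeps the colour it had in its copy of T(d): that colour
-- lies on the other branch's path, so it cuts off all the other leaves.  Each colour occurs once
-- on a path and at most d times in the copy of T(d) using it, hence at most d + 1 times.
module Submission where

open import Defs
open import Data.Nat using (ℕ; zero; suc; _+_; _*_; _^_; _≤_; _<_; z≤n)
open import Data.Nat.Properties
open import Data.Nat.Tactic.RingSolver using (solve-∀)
open import Data.List using (List; []; _∷_; _++_; length)
open import Data.List.Membership.Propositional using (_∈_)
open import Data.List.Membership.Propositional.Properties using (∈-++⁺ˡ; ∈-++⁺ʳ)
open import Data.List.Relation.Binary.Subset.Propositional using (_⊆_)
open import Data.List.Relation.Binary.Subset.Propositional.Properties using (xs⊆xs++ys; ∷⁺ʳ)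
open import Data.List.Relation.Unary.Any using (here; there)
open import Data.Product using (Σ; _×_; _,_)
open import Data.Bool using (if_then_else_)
open import Data.Empty using (⊥-elim)
open import Function using (_∘_)
open import Relation.Binary.PropositionalEquality
  using (_≡_; _≢_; refl; sym; trans; cong; cong₂; subst; module ≡-Reasoning)
open import Relation.Nullary using (¬_; yes; no)
open import Relation.Nullary.Decidable using (⌊_⌋)
import Data.Nat as N

hang : List Color → Tree → Tree
hang []       t = t
hang (c ∷ cs) t = node ((c , hang cs t) ∷ [])

hangPos : ∀ cs {t} → Pos t → Pos (hang cs t)
hangPos []       q = q
hangPos (c ∷ cs) q = child (here refl) (hangPos cs q)

pathColors-hangPos : ∀ cs {t} (q : Pos t) → pathColors (hangPos cs q) ≡ cs ++ pathColors q
pathColors-hangPos []       q = refl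
pathColors-hangPos (c ∷ cs) q = cong (c ∷_) (pathColors-hangPos cs q)

hang-leaf⁻ : ∀ cs {t} (p : Pos (hang cs t)) → IsLeaf p →
             Σ (Pos t) λ q → IsLeaf q × p ≡ hangPos cs q
hang-leaf⁻ []       p                     leaf = p , leaf , refl
hang-leaf⁻ (c ∷ cs) root                  ()
hang-leaf⁻ (c ∷ cs) (child (here refl) p) leaf with hang-leaf⁻ cs p leaf
... | q , q-leaf , refl = q , q-leaf , refl
hang-leaf⁻ (c ∷ cs) (child (there ()) p)  leaf

hang-leaf-pathColors : ∀ cs {t} (p : Pos (hang cs t)) → IsLeaf p → cs ⊆ pathColors p
hang-leaf-pathColors cs p leaf with hang-leaf⁻ cs p leaf
... | q , _ , refl = subst (_ ∈_) (sym (pathColors-hangPos cs q)) ∘ xs⊆xs++ys cs _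

leafCount-hang : ∀ cs t → leafCount (hang cs t) ≡ leafCount t
leafCount-hang []       t = refl
leafCount-hang (c ∷ cs) t = trans (+-identityʳ _) (leafCount-hang cs t)

edgeCount-hang : ∀ cs t → edgeCount (hang cs t) ≡ length cs + edgeCount t
edgeCount-hang []       t = refl
edgeCount-hang (c ∷ cs) t = cong suc (trans (+-identityʳ _) (edgeCount-hang cs t))

indicator : Color → Color → ℕ
indicator c d = if ⌊ c N.≟ d ⌋ then 1 else 0

multiplicity : Color → List Color → ℕ
multiplicity c []       = 0
multiplicity c (d ∷ ds) = indicator c d + multiplicity c ds

multiplicity-++ : ∀ c xs ys → multiplicity c (xs ++ ys) ≡ multiplicity c xs + multiplicity c ys
multiplicity-++ c []       ys = refl
multiplicity-++ c (x ∷ xs) ys =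
  trans (cong (indicator c x +_) (multiplicity-++ c xs ys))
        (sym (+-assoc (indicator c x) (multiplicity c xs) (multiplicity c ys)))

colorCount-hang : ∀ c cs t → colorCount c (hang cs t) ≡ multiplicity c cs + colorCount c t
colorCount-hang c []       t = refl
colorCount-hang c (d ∷ ds) t =
  trans (+-identityʳ _)
        (trans (cong (indicator c d +_) (colorCount-hang c ds t))
               (sym (+-assoc (indicator c d) (multiplicity c ds) (colorCount c t))))

leafCount-fork : ∀ e e' → leafCount (node (e ∷ e' ∷ [])) ≡ leafCount (node (e ∷ [])) + leafCount (node (e' ∷ []))
leafCount-fork (c , s) (c' , s') = cong (_+ leafCount (node ((c' , s') ∷ []))) (sym (+-identityʳ (leafCount s)))

edgeCount-fork : ∀ e e' → edgeCount (node (e ∷ e' ∷ [])) ≡ edgeCount (node (e ∷ [])) + edgeCount (node (e' ∷ []))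
edgeCount-fork (c , s) (c' , s') =
  cong (λ x → suc (x + edgeCount (node ((c' , s') ∷ [])))) (sym (+-identityʳ (edgeCount s)))

colorCount-fork : ∀ c e e' → colorCount c (node (e ∷ e' ∷ [])) ≡ colorCount c (node (e ∷ [])) + colorCount c (node (e' ∷ []))
colorCount-fork c (d , s) (d' , s') =
  cong (_+ colorCount c (node ((d' , s') ∷ []))) (sym (+-identityʳ (indicator c d + colorCount c s)))

Separates : List Color → Tree → Set
Separates cols t = (v : Pos t) → IsLeaf v → Σ Color λ c → c ∈ cols ×
  ((u : Pos t) → IsLeaf u → u ≢ v → c ∈ pathColors u)

separates-hang : ∀ {cols} cs {t} → Separates cols t → Separates cols (hang cs t)
separates-hang cs sep v v-leaf with hang-leaf⁻ cs v v-leaf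
... | q , q-leaf , refl with sep q q-leaf
... | c , c∈cols , cuts = c , c∈cols , cuts′
  where
  cuts′ : (u : Pos (hang cs _)) → IsLeaf u → u ≢ hangPos cs q → c ∈ pathColors u
  cuts′ u u-leaf u≢v with hang-leaf⁻ cs u u-leaf
  ... | r , r-leaf , refl = subst (c ∈_) (sym (pathColors-hangPos cs r))
                                  (∈-++⁺ʳ cs (cuts r r-leaf (u≢v ∘ cong (hangPos cs))))

separates-fork : ∀ {A B c c' s s'} → Separates A s → Separates B s' →
  ((u : Pos s') → IsLeaf u → A ⊆ c' ∷ pathColors u) →
  ((u : Pos s) → IsLeaf u → B ⊆ c ∷ pathColors u) →
  Separates (A ++ B) (node ((c , s) ∷ (c' , s') ∷ []))
separates-fork sepA sepB cutA cutB root ()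
separates-fork sepA sepB cutA cutB (child (here refl) v) v-leaf with sepA v v-leaf
... | c , c∈A , cuts = c , ∈-++⁺ˡ c∈A , λ where
  root () _
  (child (here refl) u) u-leaf u≢v → there (cuts u u-leaf (u≢v ∘ cong (child (here refl))))
  (child (there (here refl)) u) u-leaf _ → cutA u u-leaf c∈A
  (child (there (there ())) _) _ _
separates-fork {A = A} sepA sepB cutA cutB (child (there (here refl)) v) v-leaf with sepB v v-leaf
... | c , c∈B , cuts = c , ∈-++⁺ʳ A c∈B , λ where
  root () _
  (child (here refl) u) u-leaf _ → cutB u u-leaf c∈B
  (child (there (here refl)) u) u-leaf u≢v →
    there (cuts u u-leaf (u≢v ∘ cong (child (there (here refl)))))
  (child (there (there ())) _) _ _
separates-fork sepA sepB cutA cutB (child (there (there ())) v) v-leaf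

range : Color → ℕ → List Color
range lo zero    = []
range lo (suc n) = lo ∷ range (suc lo) n

range-++ : ∀ lo m n → range lo (m + n) ≡ range lo m ++ range (lo + m) n
range-++ lo zero    n = cong (λ x → range x n) (sym (+-identityʳ lo))
range-++ lo (suc m) n =
  cong (lo ∷_) (trans (range-++ (suc lo) m n) (cong (λ x → range (suc lo) m ++ range x n) (sym (+-suc lo m))))

length-range : ∀ lo n → length (range lo n) ≡ n
length-range lo zero    = refl
length-range lo (suc n) = cong suc (length-range (suc lo) n)

multiplicity-range-< : ∀ {c lo} n → c < lo → multiplicity c (range lo n) ≡ 0
multiplicity-range-< {c} {lo} zero    c<lo = refl
multiplicity-range-< {c} {lo} (suc n) c<lo with c N.≟ lo
... | yes refl = ⊥-elim (<-irrefl refl c<lo)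
... | no _     = multiplicity-range-< n (m<n⇒m<1+n c<lo)

multiplicity-range-≤1 : ∀ c lo n → multiplicity c (range lo n) ≤ 1
multiplicity-range-≤1 c lo zero    = z≤n
multiplicity-range-≤1 c lo (suc n) with c N.≟ lo
... | yes refl = ≤-reflexive (cong suc (multiplicity-range-< n ≤-refl))
... | no _     = multiplicity-range-≤1 c (suc lo) n

mersenne : ℕ → ℕ
mersenne zero    = 0
mersenne (suc d) = mersenne d + suc (mersenne d)

-- width d = 2 ^ d written as a successor, so that a run of width d visibly begins with an edge.
width : ℕ → ℕ
width d = suc (mersenne d)

width≡2^ : ∀ d → width d ≡ 2 ^ d
width≡2^ zero    = refl
width≡2^ (suc d) = cong₂ _+_ (width≡2^ d) (trans (width≡2^ d) (sym (+-identityʳ (2 ^ d))))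

-- separatingTree d lo uses the colours range lo (width d); node (branch a d lo ∷ []) is, by
-- definition, hang (range a (width d)) (separatingTree d lo).
separatingTree : ℕ → Color → Tree
branch : Color → ℕ → Color → Color × Tree

separatingTree zero    lo = node []
separatingTree (suc d) lo = node (branch (lo + width d) d lo ∷ branch lo d (lo + width d) ∷ [])

branch a d lo = a , hang (range (suc a) (mersenne d)) (separatingTree d lo)

separatingTree-separates : ∀ d lo → Separates (range lo (width d)) (separatingTree d lo)
separatingTree-separates zero lo root _ =
  lo , here refl , λ { root _ u≢v → ⊥-elim (u≢v refl) ; (child () _) _ _ }
separatingTree-separates zero lo (child () _) _
separatingTree-separates (suc d) lo =
  subst (λ cols → Separates cols (separatingTree (suc d) lo)) (sym (range-++ lo (width d) (width d)))
    (separates-fork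
      (separates-hang (range (suc (lo + width d)) (mersenne d)) (separatingTree-separates d lo))
      (separates-hang (range (suc lo) (mersenne d)) (separatingTree-separates d (lo + width d)))
      (λ u u-leaf → ∷⁺ʳ lo (hang-leaf-pathColors _ u u-leaf))
      (λ u u-leaf → ∷⁺ʳ (lo + width d) (hang-leaf-pathColors _ u u-leaf)))

leafCount-separatingTree : ∀ d lo → leafCount (separatingTree d lo) ≡ 2 ^ d
leafCount-separatingTree zero    lo = refl
leafCount-separatingTree (suc d) lo = begin
  leafCount (separatingTree (suc d) lo)
    ≡⟨ leafCount-fork (branch (lo + width d) d lo) (branch lo d (lo + width d)) ⟩
  leafCount (hang (range (lo + width d) (width d)) (separatingTree d lo))
    + leafCount (hang (range lo (width d)) (separatingTree d (lo + width d)))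
    ≡⟨ cong₂ _+_ (hung lo (lo + width d)) (hung (lo + width d) lo) ⟩
  2 ^ d + 2 ^ d
    ≡⟨ cong (2 ^ d +_) (sym (+-identityʳ (2 ^ d))) ⟩
  2 ^ suc d ∎
  where
  open ≡-Reasoning
  hung : ∀ lo a → leafCount (hang (range a (width d)) (separatingTree d lo)) ≡ 2 ^ d
  hung lo a = trans (leafCount-hang (range a (width d)) _) (leafCount-separatingTree d lo)

edgeCount-separatingTree : ∀ d lo → edgeCount (separatingTree d lo) ≡ d * 2 ^ d
edgeCount-separatingTree zero    lo = refl
edgeCount-separatingTree (suc d) lo = begin
  edgeCount (separatingTree (suc d) lo)
    ≡⟨ edgeCount-fork (branch (lo + width d) d lo) (branch lo d (lo + width d)) ⟩
  edgeCount (hang (range (lo + width d) (width d)) (separatingTree d lo))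
    + edgeCount (hang (range lo (width d)) (separatingTree d (lo + width d)))
    ≡⟨ cong₂ _+_ (hung lo (lo + width d)) (hung (lo + width d) lo) ⟩
  (2 ^ d + d * 2 ^ d) + (2 ^ d + d * 2 ^ d)
    ≡⟨ double-branches (2 ^ d) d ⟩
  suc d * 2 ^ suc d ∎
  where
  open ≡-Reasoning
  hung : ∀ lo a → edgeCount (hang (range a (width d)) (separatingTree d lo)) ≡ 2 ^ d + d * 2 ^ d
  hung lo a = begin
    edgeCount (hang (range a (width d)) (separatingTree d lo))
      ≡⟨ edgeCount-hang (range a (width d)) _ ⟩
    length (range a (width d)) + edgeCount (separatingTree d lo)
      ≡⟨ cong₂ _+_ (trans (length-range a (width d)) (width≡2^ d)) (edgeCount-separatingTree d lo) ⟩
    2 ^ d + d * 2 ^ d ∎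
  double-branches : ∀ n d → (n + d * n) + (n + d * n) ≡ suc d * (n + (n + 0))
  double-branches = solve-∀

colorCount-separatingTree : ∀ c d lo →
  colorCount c (separatingTree d lo) ≤ d * multiplicity c (range lo (width d))
colorCount-separatingTree c zero    lo = z≤n
colorCount-separatingTree c (suc d) lo = begin
  colorCount c (separatingTree (suc d) lo)
    ≡⟨ colorCount-fork c (branch (lo + width d) d lo) (branch lo d (lo + width d)) ⟩
  colorCount c (hang upper (separatingTree d lo)) + colorCount c (hang lower (separatingTree d (lo + width d)))
    ≡⟨ cong₂ _+_ (colorCount-hang c upper _) (colorCount-hang c lower _) ⟩
  (multiplicity c upper + colorCount c (separatingTree d lo))
    + (multiplicity c lower + colorCount c (separatingTree d (lo + width d)))
    ≤⟨ +-mono-≤ (+-monoʳ-≤ (multiplicity c upper) (colorCount-separatingTree c d lo))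
                (+-monoʳ-≤ (multiplicity c lower) (colorCount-separatingTree c d (lo + width d))) ⟩
  (multiplicity c upper + d * multiplicity c lower) + (multiplicity c lower + d * multiplicity c upper)
    ≡⟨ once-on-a-path d (multiplicity c lower) (multiplicity c upper) ⟩
  suc d * (multiplicity c lower + multiplicity c upper)
    ≡⟨ cong (suc d *_) (sym (trans (cong (multiplicity c) (range-++ lo (width d) (width d)))
                                   (multiplicity-++ c lower upper))) ⟩
  suc d * multiplicity c (range lo (width (suc d))) ∎
  where
  open ≤-Reasoning
  lower upper : List Color
  lower = range lo (width d)
  upper = range (lo + width d) (width d)
  once-on-a-path : ∀ d a b → (b + d * a) + (a + d * b) ≡ suc d * (a + b)
  once-on-a-path = solve-∀

lemma5p3 : (Δ : ℕ) → Σ Tree λ T →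
    ((v : Pos T) → IsLeaf v → Σ Color λ cv →
       (u : Pos T) → IsLeaf u → u ≢ v → ¬ ConnectedToRoot cv u)
    × ((c : Color) → colorCount c T ≤ Δ)
    × (leafCount T ≡ 2 ^ Δ)
    × (edgeCount T ≡ Δ * 2 ^ Δ)
lemma5p3 Δ = T , leaves-separated , colors-bounded
           , leafCount-separatingTree Δ 0 , edgeCount-separatingTree Δ 0
  where
  T : Tree
  T = separatingTree Δ 0

  leaves-separated : (v : Pos T) → IsLeaf v → Σ Color λ cv →
                     (u : Pos T) → IsLeaf u → u ≢ v → ¬ ConnectedToRoot cv u
  leaves-separated v v-leaf with separatingTree-separates Δ 0 v v-leaf
  ... | c , _ , cuts = c , λ u u-leaf u≢v connected → connected (cuts u u-leaf u≢v)

  colors-bounded : (c : Color) → colorCount c T ≤ Δ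
  colors-bounded c = begin
    colorCount c T                            ≤⟨ colorCount-separatingTree c Δ 0 ⟩
    Δ * multiplicity c (range 0 (width Δ))    ≤⟨ *-monoʳ-≤ Δ (multiplicity-range-≤1 c 0 (width Δ)) ⟩
    Δ * 1                                     ≡⟨ *-identityʳ Δ ⟩
    Δ                                         ∎
    where open ≤-Reasoning
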